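{- For every projective plane $\Pi_q$ of order $q$ and every positive integer $r<\sqrt{2q}$, $m_r(\Pi_q)=\binom{r+1}{2}$.
   Context: A finite projective plane $\Pi_q$ of order $q\ge 2$ has $q^2+q+1$ points and $q^2+q+1$ lines; every line contains $q+1$ points, every point lies on $q+1$ lines, any two lines meet in exactly one point and any two points lie on exactly one line. $r$-neighbor line percolation: for a set $A$ of points let $A^0=A$ and for $s\ge1$ let $A^s=A^{s-1}\cup\{P: \exists \text{ line } l\ni P \text{ with } |l\cap A^{s-1}|\ge r\}$; $A$ percolates if $A^k$ equals the whole point set for some $k$. $m_r(\Pi_q)$ is the minimum size of a percolating set. -}

module Defs where

open import Data.Nat using (ℕ; zero; suc; _+_; _*_; _≤_; _<_; _≤ᵇ_)
open import Data.Nat.Combinatorics using (_C_)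
open import Data.Fin using (Fin; zero; suc)
open import Data.Bool using (Bool; true; false; _∧_; _∨_; if_then_else_)
open import Data.Product using (Σ; ∃; _×_; _,_)
open import Relation.Binary.PropositionalEquality using (_≡_; _≢_)
open import Function using (_∘_)

-- A subset of Fin n is represented by its (Boolean) characteristic function.
-- count f = number of i : Fin n with f i ≡ true.
count : ∀ {n} → (Fin n → Bool) → ℕ
count {zero}  f = 0
count {suc n} f = (if f zero then 1 else 0) + count (f ∘ suc)

anyF : ∀ {n} → (Fin n → Bool) → Bool
anyF {zero}  f = false
anyF {suc n} f = f zero ∨ anyF (f ∘ suc)

size : ℕ → ℕ
size q = q * q + q + 1

-- A finite projective plane of order q ≥ 2: points and lines are both
-- indexed by Fin (q²+q+1); inc p l ≡ true means point p lies on line l.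
record ProjectivePlane (q : ℕ) : Set where
  field
    order≥2     : 2 ≤ q
    inc         : Fin (size q) → Fin (size q) → Bool
    line-size   : ∀ l → count (λ p → inc p l) ≡ suc q
    point-deg   : ∀ p → count (λ l → inc p l) ≡ suc q
    lines-meet  : ∀ l m → l ≢ m → count (λ p → inc p l ∧ inc p m) ≡ 1
    points-join : ∀ p p′ → p ≢ p′ → count (λ l → inc p l ∧ inc p′ l) ≡ 1

module _ {q : ℕ} (Π : ProjectivePlane q) (r : ℕ) where
  open ProjectivePlane Π

  PointSet : Set
  PointSet = Fin (size q) → Bool

  step : PointSet → PointSet
  step A p = A p ∨ anyF (λ l → inc p l ∧ (r ≤ᵇ count (λ x → inc x l ∧ A x)))

  iter : ℕ → PointSet → PointSet
  iter zero    A = A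
  iter (suc k) A = step (iter k A)

  Percolates : PointSet → Set
  Percolates A = ∃ λ k → ∀ p → iter k A p ≡ true

  MinPercolatingSize : ℕ → Set
  MinPercolatingSize m =
    (Σ PointSet λ A → Percolates A × count A ≡ m)
    × (∀ A → Percolates A → m ≤ count A)

module Submission where

-- Lower bound: run the percolation while recording lines. A line that
-- gets at least r points of A ∪ (recorded lines) and is not recorded yet
-- meets the j recorded lines in at most j points, so it carries at least
-- r ∸ j points of A lying on none of them. Recording such lines until
-- A ∪ (recorded lines) is closed under the percolation step, and then
-- padding with arbitrary new lines up to r lines, gives
-- |A| ≥ r + (r − 1) + … + 1 = C(r+1, 2).
--
-- Upper bound: take r + 1 lines, no three concurrent (they can be chosen
-- greedily because r ≤ q and C(r, 2) ≤ q, both consequences of r² < 2q),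
-- and let A be their C(r+1, 2) pairwise crossings. Each of these lines
-- carries r points of A, so A¹ contains all of them. Through any other
-- point P, at most C(r, 2) of the q + 1 lines pass through a crossing of
-- the last r lines; a line avoiding those crossings meets the r lines in
-- r distinct points of A¹, so A² is everything.

open import Defs
open import Data.Bool using (Bool; true; false; _∧_; _∨_; not; if_then_else_)
import Data.Bool.Properties as Bool
open import Data.Bool.Properties using (∨-zeroʳ; ∧-zeroʳ; ∧-identityʳ; ∧-distribˡ-∨; ¬-not; not-injective; T-≡)
open import Data.Bool.ListAction using (any)
open import Data.Fin using (Fin; zero; suc)
open import Data.Fin.Properties using (any?)
open import Data.List using (List; []; _∷_; length)
open import Data.List.Membership.Propositional using (_∈_; _∉_)
open import Data.List.Relation.Unary.All as All using (All; []; _∷_)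
open import Data.List.Relation.Unary.Any using (here; there)
open import Data.Nat using (ℕ; zero; suc; _+_; _*_; _∸_; _≤_; _<_; z≤n; s≤s; z<s)
open import Data.Nat.Combinatorics using (_C_; nC1≡n; nCk+nC[k+1]≡[n+1]C[k+1])
open import Data.Nat.Induction using (<-wellFounded)
open import Data.Nat.Properties
open import Data.Nat.Solver using (module +-*-Solver)
open +-*-Solver using (solve; _:+_; _:*_; _:=_; con)
open import Data.Product as Product using (∃; ∃₂; _×_; _,_; proj₁; proj₂)
open import Data.Sum using (_⊎_; inj₁; inj₂)
open import Data.Unit using (⊤; tt)
open import Function using (_∘_; id; Equivalence)
open import Induction.WellFounded using (Acc; acc)
open import Relation.Binary.PropositionalEquality
open import Relation.Nullary using (Dec; yes; no; contradiction)
open import Relation.Nullary.Decidable using (_×-dec_)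

-- Boolean subsets of Fin n

∨-true⁻ : ∀ a {b} → a ∨ b ≡ true → a ≡ true ⊎ b ≡ true
∨-true⁻ true  _ = inj₁ refl
∨-true⁻ false e = inj₂ e

∧-true⁻ : ∀ a {b} → a ∧ b ≡ true → a ≡ true × b ≡ true
∧-true⁻ true  e = refl , e
∧-true⁻ false ()

∨-trueˡ : ∀ {a} b → a ≡ true → a ∨ b ≡ true
∨-trueˡ _ refl = refl

∨-trueʳ : ∀ a {b} → b ≡ true → a ∨ b ≡ true
∨-trueʳ a refl = ∨-zeroʳ a

∧-true⁺ : ∀ {a b} → a ≡ true → b ≡ true → a ∧ b ≡ true
∧-true⁺ refl refl = refl

infix 4 _⊆_

_⊆_ : ∀ {n} → (Fin n → Bool) → (Fin n → Bool) → Set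
f ⊆ g = ∀ i → f i ≡ true → g i ≡ true

⊆-false : ∀ {n} {f g : Fin n → Bool} → f ⊆ g → ∀ {i} → g i ≡ false → f i ≡ false
⊆-false f⊆g {i} gᵢ = ¬-not λ fᵢ → contradiction (trans (sym (f⊆g i fᵢ)) gᵢ) λ ()

not-⊆ : ∀ {n} {f g : Fin n → Bool} → f ⊆ g → not ∘ g ⊆ not ∘ f
not-⊆ f⊆g i ¬gᵢ = cong not (⊆-false f⊆g (not-injective {y = false} ¬gᵢ))

∧-monoʳ-⊆ : ∀ {n} (h : Fin n → Bool) {f g : Fin n → Bool} → f ⊆ g → (λ i → h i ∧ f i) ⊆ (λ i → h i ∧ g i)
∧-monoʳ-⊆ h f⊆g i e with ∧-true⁻ (h i) e
... | hᵢ , fᵢ = ∧-true⁺ hᵢ (f⊆g i fᵢ)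

∨-monoʳ-⊆ : ∀ {n} (h : Fin n → Bool) {f g : Fin n → Bool} → f ⊆ g → (λ i → h i ∨ f i) ⊆ (λ i → h i ∨ g i)
∨-monoʳ-⊆ h f⊆g i e with ∨-true⁻ (h i) e
... | inj₁ hᵢ = ∨-trueˡ _ hᵢ
... | inj₂ fᵢ = ∨-trueʳ (h i) (f⊆g i fᵢ)

anyF⁺ : ∀ {n} (f : Fin n → Bool) i → f i ≡ true → anyF f ≡ true
anyF⁺ f zero    e = ∨-trueˡ _ e
anyF⁺ f (suc i) e = ∨-trueʳ (f zero) (anyF⁺ (f ∘ suc) i e)

anyF⁻ : ∀ {n} (f : Fin n → Bool) → anyF f ≡ true → ∃ λ i → f i ≡ true
anyF⁻ {suc n} f e with ∨-true⁻ (f zero) e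
... | inj₁ e₀ = zero , e₀
... | inj₂ e₁ with anyF⁻ (f ∘ suc) e₁
...   | i , eᵢ = suc i , eᵢ

count-cong : ∀ {n} {f g : Fin n → Bool} → (∀ i → f i ≡ g i) → count f ≡ count g
count-cong {zero}  f≗g = refl
count-cong {suc n} f≗g =
  cong₂ (λ b k → (if b then 1 else 0) + k) (f≗g zero) (count-cong (f≗g ∘ suc))

count-≡0 : ∀ {n} {f : Fin n → Bool} → (∀ i → f i ≡ false) → count f ≡ 0
count-≡0 {zero}  _ = refl
count-≡0 {suc n} f≡false rewrite f≡false zero = count-≡0 (f≡false ∘ suc)

count-all : ∀ n → count {n} (λ _ → true) ≡ n
count-all zero    = refl
count-all (suc n) = cong suc (count-all n)

count-mono : ∀ {n} {f g : Fin n → Bool} → f ⊆ g → count f ≤ count g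
count-mono {zero} _ = z≤n
count-mono {suc n} {f} {g} f⊆g with f zero in f₀ | g zero in g₀
... | false | false = count-mono (f⊆g ∘ suc)
... | false | true  = m≤n⇒m≤1+n (count-mono (f⊆g ∘ suc))
... | true  | true  = s≤s (count-mono (f⊆g ∘ suc))
... | true  | false = contradiction (trans (sym (f⊆g zero f₀)) g₀) λ ()

count-mono-< : ∀ {n} {f g : Fin n → Bool} {i} →
  f ⊆ g → g i ≡ true → f i ≡ false → count f < count g
count-mono-< {suc n} {f} {g} {zero} f⊆g gᵢ fᵢ rewrite gᵢ | fᵢ = s≤s (count-mono (f⊆g ∘ suc))
count-mono-< {suc n} {f} {g} {suc i} f⊆g gᵢ fᵢ with f zero in f₀ | g zero in g₀
... | false | false = count-mono-< (f⊆g ∘ suc) gᵢ fᵢ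
... | false | true  = m<n⇒m<1+n (count-mono-< (f⊆g ∘ suc) gᵢ fᵢ)
... | true  | true  = s≤s (count-mono-< (f⊆g ∘ suc) gᵢ fᵢ)
... | true  | false = contradiction (trans (sym (f⊆g zero f₀)) g₀) λ ()

count-<⇒∃ : ∀ {n} (f g : Fin n → Bool) → count f < count g → ∃ λ i → g i ≡ true × f i ≡ false
count-<⇒∃ {suc n} f g f<g with f zero in f₀ | g zero in g₀
... | false | true  = zero , g₀ , f₀
... | false | false = Product.map suc id (count-<⇒∃ (f ∘ suc) (g ∘ suc) f<g)
... | true  | true  = Product.map suc id (count-<⇒∃ (f ∘ suc) (g ∘ suc) (≤-pred f<g))
... | true  | false = Product.map suc id (count-<⇒∃ (f ∘ suc) (g ∘ suc) (<-trans (n<1+n _) f<g))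

count-∨+count-∧ : ∀ {n} (f g : Fin n → Bool) →
  count (λ i → f i ∨ g i) + count (λ i → f i ∧ g i) ≡ count f + count g
count-∨+count-∧ {zero} f g = refl
count-∨+count-∧ {suc n} f g with f zero | g zero | count-∨+count-∧ (f ∘ suc) (g ∘ suc)
... | true  | true  | ih = cong suc (trans (+-suc _ _) (trans (cong suc ih) (sym (+-suc _ _))))
... | true  | false | ih = cong suc ih
... | false | true  | ih = trans (cong suc ih) (sym (+-suc _ _))
... | false | false | ih = ih

count-∨-≤ : ∀ {n} (f g : Fin n → Bool) → count (λ i → f i ∨ g i) ≤ count f + count g
count-∨-≤ f g = ≤-trans (m≤m+n _ _) (≤-reflexive (count-∨+count-∧ f g))

count-∨-disjoint : ∀ {n} (f g : Fin n → Bool) → (∀ i → f i ∧ g i ≡ false) →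
  count (λ i → f i ∨ g i) ≡ count f + count g
count-∨-disjoint f g disjoint = begin
  count (λ i → f i ∨ g i)                                ≡⟨ +-identityʳ _ ⟨
  count (λ i → f i ∨ g i) + 0                            ≡⟨ cong (count (λ i → f i ∨ g i) +_) (count-≡0 disjoint) ⟨
  count (λ i → f i ∨ g i) + count (λ i → f i ∧ g i)      ≡⟨ count-∨+count-∧ f g ⟩
  count f + count g                                      ∎
  where open ≡-Reasoning

count-any-≤ : ∀ {a} {A : Set a} {n c} (h : Fin n → Bool) (R : Fin n → A → Bool) (xs : List A) →
  All (λ x → count (λ i → h i ∧ R i x) ≤ c) xs →
  count (λ i → h i ∧ any (R i) xs) ≤ length xs * c
count-any-≤ h R [] [] = ≤-reflexive (count-≡0 (λ i → ∧-zeroʳ (h i)))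
count-any-≤ {c = c} h R (x ∷ xs) (≤c ∷ ≤cs) = begin
  count (λ i → h i ∧ (R i x ∨ any (R i) xs))                     ≡⟨ count-cong (λ i → ∧-distribˡ-∨ (h i) _ _) ⟩
  count (λ i → h i ∧ R i x ∨ h i ∧ any (R i) xs)                 ≤⟨ count-∨-≤ (λ i → h i ∧ R i x) _ ⟩
  count (λ i → h i ∧ R i x) + count (λ i → h i ∧ any (R i) xs)   ≤⟨ +-mono-≤ ≤c (count-any-≤ h R xs ≤cs) ⟩
  c + length xs * c                                              ∎
  where open ≤-Reasoning

count-anyF-≤ : ∀ {m n c} (X : Fin m → Bool) (R : Fin m → Fin n → Bool) →
  (∀ x → X x ≡ true → count (R x) ≤ c) →
  count (λ i → anyF (λ x → X x ∧ R x i)) ≤ count X * c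
count-anyF-≤ {zero} X R _ = ≤-reflexive (count-≡0 {f = λ i → anyF (λ x → X x ∧ R x i)} λ _ → refl)
count-anyF-≤ {suc m} X R ≤c with X zero in X₀
... | false = count-anyF-≤ (X ∘ suc) (R ∘ suc) (≤c ∘ suc)
... | true  = ≤-trans (count-∨-≤ (R zero) (λ i → anyF (λ x → X (suc x) ∧ R (suc x) i)))
                (+-mono-≤ (≤c zero X₀) (count-anyF-≤ (X ∘ suc) (R ∘ suc) (≤c ∘ suc)))

-- Binomial coefficients

[1+n]C2≡n+nC2 : ∀ n → suc n C 2 ≡ n + n C 2
[1+n]C2≡n+nC2 n = begin
  suc n C 2      ≡⟨ nCk+nC[k+1]≡[n+1]C[k+1] n 1 ⟨
  n C 1 + n C 2  ≡⟨ cong (_+ n C 2) (nC1≡n n) ⟩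
  n + n C 2      ∎
  where open ≡-Reasoning

[1+r∸j]C2≡r∸j+[1+r∸[1+j]]C2 : ∀ r j → suc (r ∸ j) C 2 ≡ r ∸ j + suc (r ∸ suc j) C 2
[1+r∸j]C2≡r∸j+[1+r∸[1+j]]C2 zero    zero    = refl
[1+r∸j]C2≡r∸j+[1+r∸[1+j]]C2 zero    (suc j) = refl
[1+r∸j]C2≡r∸j+[1+r∸[1+j]]C2 (suc r) zero    = [1+n]C2≡n+nC2 (suc r)
[1+r∸j]C2≡r∸j+[1+r∸[1+j]]C2 (suc r) (suc j) = [1+r∸j]C2≡r∸j+[1+r∸[1+j]]C2 r j

2*nC2+n≡n*n : ∀ n → 2 * (n C 2) + n ≡ n * n
2*nC2+n≡n*n zero    = refl
2*nC2+n≡n*n (suc n) = begin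
  2 * (suc n C 2) + suc n
    ≡⟨ cong (λ c → 2 * c + suc n) ([1+n]C2≡n+nC2 n) ⟩
  2 * (n + n C 2) + suc n          ≡⟨ solve 2 (λ n c → con 2 :* (n :+ c) :+ (con 1 :+ n)
                                                     := (con 2 :* c :+ n) :+ (con 1 :+ n :+ n)) refl n (n C 2) ⟩
  (2 * (n C 2) + n) + (suc n + n)
    ≡⟨ cong (_+ (suc n + n)) (2*nC2+n≡n*n n) ⟩
  n * n + (suc n + n)
    ≡⟨ solve 1 (λ n → n :* n :+ (con 1 :+ n :+ n) := (con 1 :+ n) :* (con 1 :+ n)) refl n ⟩
  suc n * suc n ∎
  where open ≡-Reasoning

n*n<2*q⇒n≤q : ∀ n {q} → n * n < 2 * q → n ≤ q
n*n<2*q⇒n≤q n {q} n²<2q with n ≤? q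
... | yes n≤q = n≤q
... | no  n≰q = contradiction n²<2q (≤⇒≯ (begin
  2 * q          ≡⟨ cong (q +_) (+-identityʳ q) ⟩
  q + q          ≤⟨ +-monoʳ-≤ q (m≤m*n q (suc q)) ⟩
  q + q * suc q  <⟨ n<1+n _ ⟩
  suc q * suc q  ≤⟨ *-mono-≤ (≰⇒> n≰q) (≰⇒> n≰q) ⟩
  n * n          ∎))
  where open ≤-Reasoning

n*n<2*q⇒nC2<q : ∀ n {q} → n * n < 2 * q → n C 2 < q
n*n<2*q⇒nC2<q n {q} n²<2q = *-cancelˡ-< 2 (n C 2) q (begin-strict
  2 * (n C 2)      ≤⟨ m≤m+n (2 * (n C 2)) n ⟩
  2 * (n C 2) + n  ≡⟨ 2*nC2+n≡n*n n ⟩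
  n * n            <⟨ n²<2q ⟩
  2 * q            ∎)
  where open ≤-Reasoning

-- Points and lines

module _ {q : ℕ} (Π : ProjectivePlane q) where
  open ProjectivePlane Π

  Point Line : Set
  Point = Fin (size q)
  Line  = Fin (size q)

  covers : List Line → Point → Bool
  covers Ls p = any (inc p) Ls

  Misses : Line → (Point → Bool) → Set
  Misses l X = ∀ p → inc p l ≡ true → X p ≡ false

  covers⁺ : ∀ {Ls L p} → L ∈ Ls → inc p L ≡ true → covers Ls p ≡ true
  covers⁺ {L ∷ Ls} {p = p} (here refl) p∈L = ∨-trueˡ (covers Ls p) p∈L
  covers⁺ {M ∷ Ls} {p = p} (there L∈) p∈L = ∨-trueʳ (inc p M) (covers⁺ L∈ p∈L)

  covers⁻ : ∀ Ls {p} → covers Ls p ≡ true → ∃ λ L → L ∈ Ls × inc p L ≡ true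
  covers⁻ (L ∷ Ls) {p} e with ∨-true⁻ (inc p L) e
  ... | inj₁ p∈L  = L , here refl , p∈L
  ... | inj₂ p∈Ls = Product.map id (Product.map there id) (covers⁻ Ls p∈Ls)

  off-covers⇒∉ : ∀ {Ls p m} → covers Ls p ≡ false → inc p m ≡ true → m ∉ Ls
  off-covers⇒∉ off p∈m m∈Ls = contradiction (trans (sym (covers⁺ m∈Ls p∈m)) off) λ ()

  line-through : ∀ P → ∃ λ l → inc P l ≡ true
  line-through P = Product.map id proj₁ (count-<⇒∃ (λ _ → false) (inc P) 0<deg)
    where
    0<deg : count {size q} (λ _ → false) < count (inc P)
    0<deg rewrite count-≡0 {f = λ (_ : Line) → false} (λ _ → refl) | point-deg P = s≤s z≤n

  point-off : ∀ Ls → length Ls ≤ q → ∃ λ P → covers Ls P ≡ false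
  point-off Ls len≤q = Product.map id proj₂ (count-<⇒∃ (covers Ls) (λ _ → true) (begin-strict
    count (covers Ls)   ≤⟨ count-any-≤ (λ _ → true) inc Ls (All.tabulate λ {l} _ → ≤-reflexive (line-size l)) ⟩
    length Ls * suc q   ≤⟨ *-monoˡ-≤ (suc q) len≤q ⟩
    q * suc q           ≡⟨ trans (*-suc q q) (+-comm q (q * q)) ⟩
    q * q + q           <⟨ m<m+n (q * q + q) z<s ⟩
    size q              ≡⟨ count-all (size q) ⟨
    count {size q} (λ _ → true)  ∎))
    where open ≤-Reasoning

  lines-through-meeting-≤ : ∀ {P} X → X P ≡ false →
    count (λ m → anyF (λ x → X x ∧ (inc P m ∧ inc x m))) ≤ count X
  lines-through-meeting-≤ {P} X P∉X = ≤-trans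
    (count-anyF-≤ X (λ x m → inc P m ∧ inc x m)
      λ x x∈X → ≤-reflexive (points-join P x λ { refl → contradiction (trans (sym x∈X) P∉X) λ () }))
    (≤-reflexive (*-identityʳ (count X)))

  line-missing : ∀ {P} X → X P ≡ false → count X < suc q → ∃ λ m → inc P m ≡ true × Misses m X
  line-missing {P} X P∉X small
    with count-<⇒∃ (λ m → anyF (λ x → X x ∧ (inc P m ∧ inc x m))) (inc P)
           (≤-<-trans (lines-through-meeting-≤ X P∉X) (subst (count X <_) (sym (point-deg P)) small))
  ... | m , P∈m , m-misses = m , P∈m , λ x x∈m → ¬-not λ x∈X →
        contradiction (trans (sym (anyF⁺ _ x (∧-true⁺ x∈X (∧-true⁺ P∈m x∈m)))) m-misses) λ ()

  line∩covers-≤ : ∀ {l Ls} → l ∉ Ls → count (λ p → inc p l ∧ covers Ls p) ≤ length Ls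
  line∩covers-≤ {l} {Ls} l∉Ls = ≤-trans
    (count-any-≤ (λ p → inc p l) inc Ls
      (All.tabulate λ {m} m∈Ls → ≤-reflexive (lines-meet l m λ { refl → l∉Ls m∈Ls })))
    (≤-reflexive (*-identityʳ (length Ls)))

  crossings : List Line → Point → Bool
  crossings []       p = false
  crossings (L ∷ Ls) p = (inc p L ∧ covers Ls p) ∨ crossings Ls p

  -- distinct lines, no three of them concurrent
  GeneralPosition : List Line → Set
  GeneralPosition []       = ⊤
  GeneralPosition (L ∷ Ls) = L ∉ Ls × Misses L (crossings Ls) × GeneralPosition Ls

  crossings⊆covers : ∀ Ls → crossings Ls ⊆ covers Ls
  crossings⊆covers (L ∷ Ls) p e with ∨-true⁻ (inc p L ∧ covers Ls p) e
  ... | inj₁ p∈L∩Ls = ∨-trueʳ (inc p L) (proj₂ (∧-true⁻ (inc p L) p∈L∩Ls))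
  ... | inj₂ p∈×Ls  = ∨-trueʳ (inc p L) (crossings⊆covers Ls p p∈×Ls)

  crossings-∷ : ∀ L Ls → crossings Ls ⊆ crossings (L ∷ Ls)
  crossings-∷ L Ls p = ∨-trueʳ (inc p L ∧ covers Ls p)

  line∩covers-≡ : ∀ {m} Ls → GeneralPosition Ls → m ∉ Ls → Misses m (crossings Ls) →
    count (λ p → inc p m ∧ covers Ls p) ≡ length Ls
  line∩covers-≡ {m} [] _ _ _ = count-≡0 λ p → ∧-zeroʳ (inc p m)
  line∩covers-≡ {m} (L ∷ Ls) (_ , _ , gp) m∉ m-misses = begin
    count (λ p → inc p m ∧ (inc p L ∨ covers Ls p))
      ≡⟨ count-cong (λ p → ∧-distribˡ-∨ (inc p m) _ _) ⟩
    count (λ p → inc p m ∧ inc p L ∨ inc p m ∧ covers Ls p)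
      ≡⟨ count-∨-disjoint (λ p → inc p m ∧ inc p L) _ one-point ⟩
    count (λ p → inc p m ∧ inc p L) + count (λ p → inc p m ∧ covers Ls p)
      ≡⟨ cong₂ _+_ (lines-meet m L (m∉ ∘ here)) rest ⟩
    suc (length Ls) ∎
    where
    open ≡-Reasoning
    rest : count (λ p → inc p m ∧ covers Ls p) ≡ length Ls
    rest = line∩covers-≡ Ls gp (m∉ ∘ there) λ p p∈m → ⊆-false (crossings-∷ L Ls) (m-misses p p∈m)
    one-point : ∀ p → (inc p m ∧ inc p L) ∧ (inc p m ∧ covers Ls p) ≡ false
    one-point p = ¬-not λ e →
      let (m∩L , m∩Ls) = ∧-true⁻ (inc p m ∧ inc p L) e
          (p∈m , p∈L)  = ∧-true⁻ (inc p m) m∩L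
          p∈Ls         = proj₂ (∧-true⁻ (inc p m) m∩Ls)
      in contradiction (trans (sym (∨-trueˡ _ (∧-true⁺ p∈L p∈Ls))) (m-misses p p∈m)) λ ()

  count-crossings : ∀ Ls → GeneralPosition Ls → count (crossings Ls) ≡ length Ls C 2
  count-crossings [] _ = count-≡0 {f = crossings []} λ _ → refl
  count-crossings (L ∷ Ls) (L∉ , L-misses , gp) = begin
    count (λ p → (inc p L ∧ covers Ls p) ∨ crossings Ls p)
      ≡⟨ count-∨-disjoint (λ p → inc p L ∧ covers Ls p) _ off-L ⟩
    count (λ p → inc p L ∧ covers Ls p) + count (crossings Ls)
      ≡⟨ cong₂ _+_ (line∩covers-≡ Ls gp L∉ L-misses) (count-crossings Ls gp) ⟩
    length Ls + length Ls C 2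
      ≡⟨ [1+n]C2≡n+nC2 (length Ls) ⟨
    suc (length Ls) C 2 ∎
    where
    open ≡-Reasoning
    off-L : ∀ p → (inc p L ∧ covers Ls p) ∧ crossings Ls p ≡ false
    off-L p = ¬-not λ e →
      let (L∩Ls , p∈×Ls) = ∧-true⁻ (inc p L ∧ covers Ls p) e
      in contradiction (trans (sym p∈×Ls) (L-misses p (proj₁ (∧-true⁻ (inc p L) L∩Ls)))) λ ()

  line∩crossings-≥ : ∀ {L} Ls → GeneralPosition Ls → L ∈ Ls →
    length Ls ≤ suc (count (λ p → inc p L ∧ crossings Ls p))
  line∩crossings-≥ {L} (L ∷ Ms) (L∉ , L-misses , gp) (here refl) = s≤s (begin
    length Ms
      ≡⟨ line∩covers-≡ Ms gp L∉ L-misses ⟨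
    count (λ p → inc p L ∧ covers Ms p)
      ≤⟨ count-mono (λ p e → ∧-true⁺ (proj₁ (∧-true⁻ (inc p L) e)) (∨-trueˡ _ e)) ⟩
    count (λ p → inc p L ∧ crossings (L ∷ Ms) p) ∎)
    where open ≤-Reasoning
  line∩crossings-≥ {L} (M ∷ Ms) (M∉ , M-misses , gp) (there L∈) = s≤s (begin
    length Ms
      ≤⟨ line∩crossings-≥ Ms gp L∈ ⟩
    suc (count (λ p → inc p L ∧ crossings Ms p))
      ≡⟨ cong (_+ _) (lines-meet L M L≢M) ⟨
    count (λ p → inc p L ∧ inc p M) + count (λ p → inc p L ∧ crossings Ms p)
      ≡⟨ count-∨-disjoint (λ p → inc p L ∧ inc p M) _ off-M ⟨
    count (λ p → inc p L ∧ inc p M ∨ inc p L ∧ crossings Ms p)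
      ≤⟨ count-mono new-or-old ⟩
    count (λ p → inc p L ∧ crossings (M ∷ Ms) p) ∎)
    where
    open ≤-Reasoning
    L≢M : L ≢ M
    L≢M L≡M = M∉ (subst (_∈ Ms) L≡M L∈)
    off-M : ∀ p → (inc p L ∧ inc p M) ∧ (inc p L ∧ crossings Ms p) ≡ false
    off-M p = ¬-not λ e →
      let (L∩M , L∩×Ms) = ∧-true⁻ (inc p L ∧ inc p M) e
      in contradiction (trans (sym (proj₂ (∧-true⁻ (inc p L) L∩×Ms)))
                              (M-misses p (proj₂ (∧-true⁻ (inc p L) L∩M)))) λ ()
    new-or-old : (λ p → inc p L ∧ inc p M ∨ inc p L ∧ crossings Ms p)
               ⊆ (λ p → inc p L ∧ crossings (M ∷ Ms) p)
    new-or-old p e with ∨-true⁻ (inc p L ∧ inc p M) e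
    ... | inj₁ L∩M  = let (p∈L , p∈M) = ∧-true⁻ (inc p L) L∩M
                      in ∧-true⁺ p∈L (∨-trueˡ _ (∧-true⁺ p∈M (covers⁺ L∈ p∈L)))
    ... | inj₂ L∩×Ms = ∧-monoʳ-⊆ (λ p → inc p L) (crossings-∷ M Ms) p L∩×Ms

  GeneralPosition-∷ : ∀ Ls → GeneralPosition Ls → length Ls ≤ q → length Ls C 2 < suc q →
    ∃ λ L → GeneralPosition (L ∷ Ls)
  GeneralPosition-∷ Ls gp len≤q few-crossings with point-off Ls len≤q
  ... | P , P∉covers
    with line-missing (crossings Ls) (⊆-false (crossings⊆covers Ls) P∉covers)
                      (subst (_< suc q) (sym (count-crossings Ls gp)) few-crossings)
  ...   | L , P∈L , L-misses = L , off-covers⇒∉ P∉covers P∈L , L-misses , gp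

  general-position-exists : ∀ n → n * n < 2 * q →
    ∃₂ λ L Ls → GeneralPosition (L ∷ Ls) × length Ls ≡ n
  general-position-exists zero _ =
    Product.map id (λ gp → [] , gp , refl) (GeneralPosition-∷ [] tt z≤n z<s)
  general-position-exists (suc n) n²<2q =
    let (L , Ls , gp , len≡n) =
          general-position-exists n (≤-<-trans (*-mono-≤ (n≤1+n n) (n≤1+n n)) n²<2q)
        len≡1+n : length (L ∷ Ls) ≡ suc n
        len≡1+n = cong suc len≡n
        (L′ , gp′) = GeneralPosition-∷ (L ∷ Ls) gp
                       (subst (_≤ q) (sym len≡1+n) (n*n<2*q⇒n≤q (suc n) n²<2q))
                       (subst (λ k → k C 2 < suc q) (sym len≡1+n) (m<n⇒m<1+n (n*n<2*q⇒nC2<q (suc n) n²<2q)))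
    in L′ , L ∷ Ls , gp′ , len≡1+n

  -- Percolation

  module _ (r : ℕ) where

    Closed : (Point → Bool) → Set
    Closed C = ∀ l → r ≤ count (λ p → inc p l ∧ C p) → ∀ p → inc p l ≡ true → C p ≡ true

    step-inflationary : ∀ X {p} → X p ≡ true → step Π r X p ≡ true
    step-inflationary X = ∨-trueˡ _

    step-spreads : ∀ X {p l} → inc p l ≡ true → r ≤ count (λ x → inc x l ∧ X x) → step Π r X p ≡ true
    step-spreads X {p} {l} p∈l heavy =
      ∨-trueʳ (X p) (anyF⁺ _ l (∧-true⁺ p∈l (Equivalence.to T-≡ (≤⇒≤ᵇ heavy))))

    iter-⊆-closed : ∀ {A C} → A ⊆ C → Closed C → ∀ k → iter Π r k A ⊆ C
    iter-⊆-closed A⊆C closed zero = A⊆C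
    iter-⊆-closed {A} {C} A⊆C closed (suc k) p p∈Aᵏ⁺¹ with ∨-true⁻ (iter Π r k A p) p∈Aᵏ⁺¹
    ... | inj₁ p∈Aᵏ = iter-⊆-closed A⊆C closed k p p∈Aᵏ
    ... | inj₂ spread with anyF⁻ _ spread
    ...   | l , e with ∧-true⁻ (inc p l) e
    ...     | p∈l , heavy = closed l
                (≤-trans (≤ᵇ⇒≤ r _ (Equivalence.from T-≡ heavy))
                         (count-mono (∧-monoʳ-⊆ (λ x → inc x l) (iter-⊆-closed A⊆C closed k))))
                p p∈l

    module _ (A : Point → Bool) where

      hull : List Line → Point → Bool
      hull Ls p = A p ∨ covers Ls p

      -- |A ∩ ⋃ Ls| ≥ r + (r ∸ 1) + … + (r ∸ (j ∸ 1)) for j = length Ls, stated without a sum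
      -- through suc r C 2 = r + (r ∸ 1) + … + (r ∸ (j ∸ 1)) + suc (r ∸ j) C 2.
      Charged : List Line → Set
      Charged Ls = suc r C 2 ≤ count (λ p → A p ∧ covers Ls p) + suc (r ∸ length Ls) C 2

      Charged-[] : Charged []
      Charged-[] = m≤n+m _ _

      Charged-∷ : ∀ Ls {l} → l ∉ Ls → r ≤ count (λ p → inc p l ∧ hull Ls p) →
        Charged Ls → Charged (l ∷ Ls)
      Charged-∷ Ls {l} l∉Ls heavy charged = begin
        suc r C 2                                ≤⟨ charged ⟩
        old + suc (r ∸ length Ls) C 2            ≡⟨ cong (old +_) ([1+r∸j]C2≡r∸j+[1+r∸[1+j]]C2 r (length Ls)) ⟩
        old + (r ∸ length Ls + rest)             ≤⟨ +-monoʳ-≤ old (+-monoˡ-≤ rest enough-fresh) ⟩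
        old + (new + rest)                       ≡⟨ +-assoc old new rest ⟨
        old + new + rest                         ≡⟨ cong (_+ rest) (trans (+-comm old new) (sym split)) ⟩
        count (λ p → A p ∧ covers (l ∷ Ls) p) + rest ∎
        where
        open ≤-Reasoning
        fresh : Point → Bool
        fresh p = A p ∧ inc p l ∧ not (covers Ls p)
        old new rest : ℕ
        old  = count (λ p → A p ∧ covers Ls p)
        new  = count fresh
        rest = suc (r ∸ suc (length Ls)) C 2

        fresh-or-covered : ∀ a b c → b ∧ (a ∨ c) ≡ true → (a ∧ b ∧ not c) ∨ (b ∧ c) ≡ true
        fresh-or-covered true  true  false _ = refl
        fresh-or-covered a     true  true  _ = ∨-zeroʳ _
        fresh-or-covered false true  false ()
        fresh-or-covered a     false c     ()

        split-by-old : ∀ a b c → a ∧ (b ∨ c) ≡ (a ∧ b ∧ not c) ∨ (a ∧ c)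
        split-by-old false b     c     = refl
        split-by-old true  true  true  = refl
        split-by-old true  true  false = refl
        split-by-old true  false true  = refl
        split-by-old true  false false = refl

        fresh-not-old : ∀ a b c → (a ∧ b ∧ not c) ∧ (a ∧ c) ≡ false
        fresh-not-old false b     c     = refl
        fresh-not-old true  true  true  = refl
        fresh-not-old true  true  false = refl
        fresh-not-old true  false c     = refl

        split : count (λ p → A p ∧ covers (l ∷ Ls) p) ≡ new + old
        split = trans (count-cong λ p → split-by-old (A p) (inc p l) (covers Ls p))
                      (count-∨-disjoint fresh _ λ p → fresh-not-old (A p) (inc p l) (covers Ls p))

        enough-fresh : r ∸ length Ls ≤ new
        enough-fresh = m≤n+o⇒m∸n≤o r (length Ls) (begin
          r
            ≤⟨ heavy ⟩
          count (λ p → inc p l ∧ hull Ls p)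
            ≤⟨ count-mono (λ p → fresh-or-covered (A p) (inc p l) (covers Ls p)) ⟩
          count (λ p → fresh p ∨ (inc p l ∧ covers Ls p))
            ≤⟨ count-∨-≤ fresh _ ⟩
          new + count (λ p → inc p l ∧ covers Ls p)
            ≤⟨ +-monoʳ-≤ new (line∩covers-≤ l∉Ls) ⟩
          new + length Ls
            ≡⟨ +-comm new (length Ls) ⟩
          length Ls + new ∎)

      hull-∷ : ∀ Ls l → hull Ls ⊆ hull (l ∷ Ls)
      hull-∷ Ls l = ∨-monoʳ-⊆ A λ p → ∨-trueʳ (inc p l)

      Spreading : List Line → Line → Set
      Spreading Ls l =
        r ≤ count (λ p → inc p l ∧ hull Ls p) × ∃ λ p → inc p l ≡ true × hull Ls p ≡ false

      spreading? : ∀ Ls → Dec (∃ (Spreading Ls))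
      spreading? Ls =
        any? λ l → (r ≤? _) ×-dec any? λ p → (inc p l Bool.≟ true) ×-dec (hull Ls p Bool.≟ false)

      saturate : ∀ Ls → Acc _<_ (count (not ∘ hull Ls)) → Charged Ls →
        ∃ λ Ls′ → Charged Ls′ × Closed (hull Ls′)
      saturate Ls (acc smaller) charged with spreading? Ls
      ... | no none = Ls , charged , λ l heavy p p∈l → ¬-not λ p∉ → none (l , heavy , p , p∈l , p∉)
      ... | yes (l , heavy , p , p∈l , p∉) =
        saturate (l ∷ Ls) (smaller uncovered-shrinks)
                 (Charged-∷ Ls (off-covers⇒∉ p∉covers p∈l) heavy charged)
        where
        p∉covers : covers Ls p ≡ false
        p∉covers = ⊆-false {f = covers Ls} (λ p → ∨-trueʳ (A p)) p∉
        uncovered-shrinks : count (not ∘ hull (l ∷ Ls)) < count (not ∘ hull Ls)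
        uncovered-shrinks =
          count-mono-< (not-⊆ (hull-∷ Ls l)) (cong not p∉) (cong not (∨-trueʳ (A p) (∨-trueˡ _ p∈l)))

      Charged⇒≥ : ∀ Ls → r ≤ length Ls → Charged Ls → suc r C 2 ≤ count A
      Charged⇒≥ Ls r≤len charged = begin
        suc r C 2
          ≤⟨ charged ⟩
        count (λ p → A p ∧ covers Ls p) + suc (r ∸ length Ls) C 2
          ≡⟨ cong (λ d → count (λ p → A p ∧ covers Ls p) + suc d C 2) (m≤n⇒m∸n≡0 r≤len) ⟩
        count (λ p → A p ∧ covers Ls p) + 0
          ≡⟨ +-identityʳ _ ⟩
        count (λ p → A p ∧ covers Ls p)
          ≤⟨ count-mono (λ p → proj₁ ∘ ∧-true⁻ (A p)) ⟩
        count A ∎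
        where open ≤-Reasoning

      covering-Charged⇒≥ : r ≤ q → ∀ d Ls → length Ls + d ≡ r →
        (∀ p → hull Ls p ≡ true) → Charged Ls → suc r C 2 ≤ count A
      covering-Charged⇒≥ _ zero Ls len≡r _ charged =
        Charged⇒≥ Ls (≤-reflexive (trans (sym len≡r) (+-identityʳ _))) charged
      covering-Charged⇒≥ r≤q (suc d) Ls len+d≡r full charged
        with point-off Ls (≤-trans (m≤m+n _ _) (≤-trans (≤-reflexive len+d≡r) r≤q))
      ... | P , P∉covers with line-through P
      ...   | l , P∈l =
        covering-Charged⇒≥ r≤q d (l ∷ Ls) (trans (sym (+-suc _ d)) len+d≡r) (λ p → hull-∷ Ls l p (full p))
            (Charged-∷ Ls (off-covers⇒∉ P∉covers P∈l) heavy charged)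
        where
        heavy : r ≤ count (λ p → inc p l ∧ hull Ls p)
        heavy = ≤-trans (≤-trans r≤q (n≤1+n q)) (≤-reflexive (trans (sym (line-size l))
                  (count-cong λ p → trans (sym (∧-identityʳ _)) (cong (inc p l ∧_) (sym (full p))))))

      percolating⇒covering-Charged : Percolates Π r A → ∃ λ Ls → Charged Ls × (∀ p → hull Ls p ≡ true)
      percolating⇒covering-Charged (k , percolated) with saturate [] (<-wellFounded _) Charged-[]
      ... | Ls , charged , closed =
        Ls , charged , λ p → iter-⊆-closed (λ _ → ∨-trueˡ _) closed k p (percolated p)

      percolating⇒≥ : r ≤ q → Percolates Π r A → suc r C 2 ≤ count A
      percolating⇒≥ r≤q percolates with percolating⇒covering-Charged percolates
      ... | Ls , charged , full with r ≤? length Ls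
      ...   | yes r≤len = Charged⇒≥ Ls r≤len charged
      ...   | no  r≰len =
        covering-Charged⇒≥ r≤q (r ∸ length Ls) Ls (m+[n∸m]≡n (<⇒≤ (≰⇒> r≰len))) full charged

    crossings-percolate : ∀ {L₀} Ls → GeneralPosition (L₀ ∷ Ls) → length Ls ≡ r → r C 2 < suc q →
      Percolates Π r (crossings (L₀ ∷ Ls))
    crossings-percolate {L₀} Ls gp@(_ , _ , gp′) len≡r few-crossings = 2 , all-in-A²
      where
      A : Point → Bool
      A = crossings (L₀ ∷ Ls)

      covered-in-A¹ : covers (L₀ ∷ Ls) ⊆ iter Π r 1 A
      covered-in-A¹ p p∈ with covers⁻ (L₀ ∷ Ls) p∈
      ... | L , L∈ , p∈L =
        step-spreads A p∈L (≤-pred (subst (λ n → suc n ≤ suc (count (λ x → inc x L ∧ A x))) len≡r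
                                          (line∩crossings-≥ (L₀ ∷ Ls) gp L∈)))

      off-Ls-in-A² : ∀ {p} → covers Ls p ≡ false → iter Π r 2 A p ≡ true
      off-Ls-in-A² {p} p∉Ls
        with line-missing (crossings Ls) (⊆-false (crossings⊆covers Ls) p∉Ls)
               (subst (_< suc q) (sym (trans (count-crossings Ls gp′) (cong (_C 2) len≡r))) few-crossings)
      ... | m , p∈m , m-misses = step-spreads (iter Π r 1 A) p∈m (begin
        r
          ≡⟨ len≡r ⟨
        length Ls
          ≡⟨ line∩covers-≡ Ls gp′ (off-covers⇒∉ p∉Ls p∈m) m-misses ⟨
        count (λ x → inc x m ∧ covers Ls x)
          ≤⟨ count-mono (∧-monoʳ-⊆ (λ x → inc x m) λ x → covered-in-A¹ x ∘ ∨-trueʳ (inc x L₀)) ⟩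
        count (λ x → inc x m ∧ iter Π r 1 A x) ∎)
        where open ≤-Reasoning

      all-in-A² : ∀ p → iter Π r 2 A p ≡ true
      all-in-A² p with covers Ls p Bool.≟ true
      ... | yes p∈Ls = step-inflationary (iter Π r 1 A) (covered-in-A¹ p (∨-trueʳ (inc p L₀) p∈Ls))
      ... | no  p∉Ls = off-Ls-in-A² (¬-not p∉Ls)

proposition8 : ∀ (q : ℕ) (Π : ProjectivePlane q) (r : ℕ) →
    1 ≤ r → r * r < 2 * q →
    MinPercolatingSize Π r (suc r C 2)
proposition8 q Π r _ r²<2q with general-position-exists Π r r²<2q
... | L₀ , Ls , gp , len≡r =
  ( crossings Π (L₀ ∷ Ls)
  , crossings-percolate Π r Ls gp len≡r (m<n⇒m<1+n (n*n<2*q⇒nC2<q r r²<2q))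
  , trans (count-crossings Π (L₀ ∷ Ls) gp) (cong (λ n → suc n C 2) len≡r) )
  , λ A → percolating⇒≥ Π r A (n*n<2*q⇒n≤q r r²<2q)
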